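{- There exists a string automatic graph (a string automatic structure with a single binary relation) of bounded degree whose growth is intermediate, i.e., its normalized growth function is neither in $n^{O(1)}$ nor in $2^{\Omega(n)}$.
   Context: A structure (finite relational signature) is string automatic if it is isomorphic to $(L,(R_r)_r)/{\equiv}$ where $L\subseteq\Gamma^*$ is regular and the relations $R_r\subseteq L^{m_r}$ and the congruence $\equiv$ are recognized by synchronous multi-tape finite automata (reading the padded convolution of strings letter by letter). The Gaifman graph of a structure has an edge between $a,b$ iff they occur together in a tuple of some relation; $S(n,a)$ is the set of elements at distance $\le n$ from $a$. The structure has bounded degree if some constant bounds the number of neighbours of every node; for such structures the growth function is $g(n)=\max_a|S(n,a)|$ and the normalized growth function is $g'(n)=\max\{n,g(n)\}$. -}

module Defs where

open import Data.Nat using (ℕ; zero; suc; _+_; _*_; _^_; _≤_; _⊔_)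
open import Data.Fin using (Fin)
open import Data.Bool using (Bool; true)
open import Data.List using (List; []; _∷_; foldl; length)
open import Data.List.Relation.Unary.All using (All)
open import Data.List.Relation.Unary.AllPairs using (AllPairs)
open import Data.Maybe using (Maybe; just; nothing)
open import Data.Product using (Σ; _×_; _,_; ∃; ∃-syntax)
open import Data.Sum using (_⊎_)
open import Relation.Nullary using (¬_)
open import Relation.Binary.PropositionalEquality using (_≡_)

record DFA (A : Set) : Set where
  field
    states : ℕ
    start  : Fin states
    δ      : Fin states → A → Fin states
    accept : Fin states → Bool

run : {A : Set} (M : DFA A) → List A → Fin (DFA.states M)
run M w = foldl (DFA.δ M) (DFA.start M) w

Accepts : {A : Set} → DFA A → List A → Set
Accepts M w = DFA.accept M (run M w) ≡ true

conv : {A : Set} → List A → List A → List (Maybe A × Maybe A)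
conv []       []       = []
conv (a ∷ u)  []       = (just a , nothing) ∷ conv u []
conv []       (b ∷ v)  = (nothing , just b) ∷ conv [] v
conv (a ∷ u)  (b ∷ v)  = (just a , just b) ∷ conv u v

Rel2 : {A : Set} → DFA (Maybe A × Maybe A) → List A → List A → Set
Rel2 M u v = Accepts M (conv u v)

-- A string automatic presentation of a graph (single binary relation):
-- alphabet Γ = Fin k, a regular domain L ⊆ Γ*, an automatic edge
-- relation E and an automatic congruence ≡ (on L).

record AutoPres : Set₁ where
  field
    k    : ℕ
    domA : DFA (Fin k)
    edgA : DFA (Maybe (Fin k) × Maybe (Fin k))
    eqvA : DFA (Maybe (Fin k) × Maybe (Fin k))

  Elt : Set
  Elt = Σ (List (Fin k)) (λ w → Accepts domA w)

  E : Elt → Elt → Set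
  E (u , _) (v , _) = Rel2 edgA u v

  _≈_ : Elt → Elt → Set
  (u , _) ≈ (v , _) = Rel2 eqvA u v

record IsCongruence (P : AutoPres) : Set where
  open AutoPres P
  field
    refl′  : ∀ a → a ≈ a
    sym′   : ∀ {a b} → a ≈ b → b ≈ a
    trans′ : ∀ {a b c} → a ≈ b → b ≈ c → a ≈ c
    compat : ∀ {a a′ b b′} → a ≈ a′ → b ≈ b′ → E a b → E a′ b′

-- Gaifman graph of the quotient structure (L,E)/≡, described on
-- representatives: classes [a],[b] are adjacent iff E a b or E b a
-- (well defined by congruence).  Distinct classes are counted by lists
-- of pairwise ≡-inequivalent representatives.

module _ (P : AutoPres) where
  open AutoPres P

  Adj : Elt → Elt → Set
  Adj a b = E a b ⊎ E b a

  data Within : ℕ → Elt → Elt → Set where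
    here : ∀ {n a b} → a ≈ b → Within n a b
    step : ∀ {n a c b} → Adj a c → Within n c b → Within (suc n) a b

  Distinct : List Elt → Set
  Distinct = AllPairs (λ a b → ¬ (a ≈ b))

  BoundedDegree : Set
  BoundedDegree = ∃[ d ] ∀ (a : Elt) (xs : List Elt) →
    All (λ b → Adj a b × ¬ (a ≈ b)) xs → Distinct xs → length xs ≤ d

  BallAtMost : ℕ → Elt → ℕ → Set
  BallAtMost n a x = ∀ (xs : List Elt) → All (Within n a) xs → Distinct xs → length xs ≤ x

  BallAtLeast : ℕ → Elt → ℕ → Set
  BallAtLeast n a x = ∃[ xs ] (All (Within n a) xs × Distinct xs × x ≤ length xs)

  -- g(n) = max_a |S(n,a)|
  GrowthAtMost : ℕ → ℕ → Set
  GrowthAtMost n x = ∀ (a : Elt) → BallAtMost n a x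

  GrowthAtLeast : ℕ → ℕ → Set
  GrowthAtLeast n x = ∃[ a ] BallAtLeast n a x

  -- g'(n) = max {n , g(n)}
  NormGrowthAtMost : ℕ → ℕ → Set
  NormGrowthAtMost n x = n ≤ x × GrowthAtMost n x

  NormGrowthAtLeast : ℕ → ℕ → Set
  NormGrowthAtLeast n x = x ≤ n ⊎ GrowthAtLeast n x

  PolyGrowth : Set
  PolyGrowth = ∃[ C ] ∃[ d ] ∃[ N ] ∀ n → N ≤ n → NormGrowthAtMost n (C * n ^ d)

  -- g' ∈ 2^{Ω(n)} : ∃ ε > 0, N. ∀ n ≥ N. g'(n) ≥ 2^{εn}; with ε = 1/(c+1)
  -- this reads 2^n ≤ g'(n)^(c+1), i.e. some x ≤ g'(n) has 2^n ≤ x^(c+1).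
  ExpGrowth : Set
  ExpGrowth = ∃[ c ] ∃[ N ] ∀ n → N ≤ n →
    ∃[ x ] (2 ^ n ≤ x ^ suc c × NormGrowthAtLeast n x)

module Submission where

-- Nodes are pairs (w , p) of a nonempty bit word and a cursor p < |w|; the
-- cursor moves right, and from the last position the node grows into
-- (w0 , 0) and (w1 , 0): a binary tree with ever longer subdivided edges.
-- Writing w with position p marked, both steps are checked letter by letter
-- by a two-tape automaton, and ≡ is string equality.  Every step increases
-- the depth tri (|w| - 1) + p by one (tri = triangular numbers).  Lower
-- bound: the 2^m nodes (0t , 0), |t| = m, lie at distance tri m from the
-- root.  Upper bound: in a ball of radius n = tri s all words share a prefix
-- of length K, have at most K + 2s letters and depths in an interval of
-- length 2n, so the ball has at most (2n + 1)·2^(2s+1) ≤ 2^(4s+1) elements.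

open import Defs
open import Data.Product using (∃-syntax; _×_)
open import Relation.Nullary using (¬_)

open import Data.Nat using (ℕ; zero; suc; _+_; _*_; _^_; _∸_; _≤_; _<_; z≤n; s≤s; s≤s⁻¹; pred; _<?_)
open import Data.Nat.Properties hiding (_≟_)
open import Data.Nat.Tactic.RingSolver using (solve-∀)
open import Data.Fin using (Fin; zero; suc; _≟_)
open import Data.Bool using (Bool; false; true; if_then_else_)
import Data.Bool as Bool
import Data.List as List
open import Data.List using (List; []; _∷_; [_]; foldl; length; map; _++_; take; drop; upTo; cartesianProduct)
open import Data.List.Properties
  using (length-++; length-map; length-drop; length-applyUpTo; length-removeAt′; take++drop≡id; take-all;
         ++-identityʳ; ++-assoc; ∷-injectiveʳ; ≡-dec)
open import Data.List.Relation.Unary.All using (All; []; _∷_; tabulate) renaming (map to All-map)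
open import Data.List.Relation.Unary.All.Properties using (++⁺; map⁺)
open import Data.List.Relation.Unary.AllPairs using (AllPairs; []; _∷_) renaming (map to AllPairs-map)
import Data.List.Relation.Unary.AllPairs.Properties as AllPairs
open import Data.List.Relation.Unary.Any using (here; there; _─_)
open import Data.List.Membership.Propositional using (_∈_)
open import Data.List.Membership.Propositional.Properties
  using (∈-map⁺; ∈-++⁺ˡ; ∈-++⁺ʳ; ∈-cartesianProduct⁺; ∈-upTo⁺)
open import Data.Maybe using (Maybe; just; nothing)
open import Data.Product using (_,_; proj₁; proj₂)
open import Data.Sum using (_⊎_; inj₁; inj₂)
open import Data.Empty using (⊥-elim)
open import Relation.Nullary using (Dec; yes; no; does)
open import Relation.Unary using (Decidable)
open import Relation.Binary.Definitions using (DecidableEquality)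
open import Relation.Binary.Construct.Closure.ReflexiveTransitive using (Star; ε; _◅_; _◅◅_)
open import Relation.Binary.PropositionalEquality
  using (_≡_; _≢_; refl; sym; trans; cong; cong₂; subst; subst₂; module ≡-Reasoning)

∈-─ : ∀ {B : Set} {x y : B} (R : List B) (i : x ∈ R) → y ∈ R → y ≢ x → y ∈ (R ─ i)
∈-─ (r ∷ R) (here refl) (here refl) y≢x = ⊥-elim (y≢x refl)
∈-─ (r ∷ R) (here refl) (there j)   y≢x = j
∈-─ (r ∷ R) (there i)   (here refl) y≢x = here refl
∈-─ (r ∷ R) (there i)   (there j)   y≢x = there (∈-─ R i j y≢x)

module _ {A B : Set} (_≈_ : A → A → Set) (Q : A → Set) (f : A → B)
         (f-injective : ∀ {x y} → Q x → Q y → f x ≡ f y → x ≈ y) where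

  pigeonhole : ∀ (R : List B) xs → All Q xs → (∀ {x} → Q x → f x ∈ R) →
               AllPairs (λ a b → ¬ (a ≈ b)) xs → length xs ≤ length R
  pigeonhole R xs qs into = count R xs qs (All-map into qs)
    where
    count : ∀ (R : List B) xs → All Q xs → All (λ x → f x ∈ R) xs →
            AllPairs (λ a b → ¬ (a ≈ b)) xs → length xs ≤ length R
    count R []       _          _          _           = z≤n
    count R (x ∷ xs) (qx ∷ qs) (fx∈R ∷ ms) (x≉xs ∷ ds) = begin
      suc (length xs)         ≤⟨ s≤s (count (R ─ fx∈R) xs qs (rest xs qs ms x≉xs) ds) ⟩
      suc (length (R ─ fx∈R)) ≡⟨ length-removeAt′ R _ ⟨
      length R                ∎
      where
      open ≤-Reasoning
      rest : ∀ ys → All Q ys → All (λ y → f y ∈ R) ys → All (λ y → ¬ (x ≈ y)) ys →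
             All (λ y → f y ∈ (R ─ fx∈R)) ys
      rest []       _          _          _            = []
      rest (y ∷ ys) (qy ∷ qys) (my ∷ mys) (x≉y ∷ x≉ys) =
        ∈-─ R fx∈R my (λ e → x≉y (f-injective qx qy (sym e))) ∷ rest ys qys mys x≉ys

-- Used to locate
-- the level above which a ball cannot change the word.
first-crossing : ∀ {P : ℕ → Set} → Decidable P → ∀ m → P m →
                 ∃[ K ] (P K × (K ≡ 0 ⊎ ∃[ j ] (K ≡ suc j × ¬ P j)))
first-crossing P? zero    p = zero , p , inj₁ refl
first-crossing P? (suc m) p with P? m
... | yes pm = first-crossing P? m pm
... | no ¬pm = suc m , p , inj₂ (m , refl , ¬pm)

extend : List (List Bool) → List (List Bool)
extend ws = map (false ∷_) ws ++ map (true ∷_) ws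

length-extend : ∀ ws → length (extend ws) ≡ length ws + length ws
length-extend ws = begin
  length (map (false ∷_) ws ++ map (true ∷_) ws)            ≡⟨ length-++ (map (false ∷_) ws) ⟩
  length (map (false ∷_) ws) + length (map (true ∷_) ws)    ≡⟨ cong₂ _+_ (length-map _ ws) (length-map _ ws) ⟩
  length ws + length ws                                     ∎
  where open ≡-Reasoning

∈-extend : ∀ {w ws} b → w ∈ ws → b ∷ w ∈ extend ws
∈-extend {ws = ws} false w∈ws = ∈-++⁺ˡ (∈-map⁺ (false ∷_) w∈ws)
∈-extend {ws = ws} true  w∈ws = ∈-++⁺ʳ (map (false ∷_) ws) (∈-map⁺ (true ∷_) w∈ws)

words : ℕ → List (List Bool)
words zero    = [ [] ]
words (suc m) = extend (words m)

length-words : ∀ m → length (words m) ≡ 2 ^ m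
length-words zero    = refl
length-words (suc m) = begin
  length (extend (words m))              ≡⟨ length-extend (words m) ⟩
  length (words m) + length (words m)    ≡⟨ cong (λ k → k + k) (length-words m) ⟩
  2 ^ m + 2 ^ m                          ≡⟨ cong (2 ^ m +_) (+-identityʳ (2 ^ m)) ⟨
  2 ^ suc m                              ∎
  where open ≡-Reasoning

words-length : ∀ m → All (λ w → length w ≡ m) (words m)
words-length zero    = refl ∷ []
words-length (suc m) = ++⁺ (map⁺ (All-map (cong suc) (words-length m)))
                           (map⁺ (All-map (cong suc) (words-length m)))

words-distinct : ∀ m → AllPairs _≢_ (words m)
words-distinct zero    = [] ∷ []
words-distinct (suc m) = AllPairs.++⁺ (AllPairs.map⁺ (AllPairs-map tail-distinct (words-distinct m)))
                                      (AllPairs.map⁺ (AllPairs-map tail-distinct (words-distinct m)))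
                                      (map⁺ (tabulate λ _ → map⁺ (tabulate λ _ ())))
  where
  tail-distinct : ∀ {b v w} → v ≢ w → b ∷ v ≢ b ∷ w
  tail-distinct v≢w e = v≢w (∷-injectiveʳ e)

wordsUpTo : ℕ → List (List Bool)
wordsUpTo zero    = [ [] ]
wordsUpTo (suc L) = [] ∷ extend (wordsUpTo L)

∈-wordsUpTo : ∀ L w → length w ≤ L → w ∈ wordsUpTo L
∈-wordsUpTo zero    []      _         = here refl
∈-wordsUpTo (suc L) []      _         = here refl
∈-wordsUpTo (suc L) (b ∷ w) (s≤s w≤L) = there (∈-extend b (∈-wordsUpTo L w w≤L))

length-wordsUpTo : ∀ L → length (wordsUpTo L) < 2 ^ suc L
length-wordsUpTo zero    = s≤s (s≤s z≤n)
length-wordsUpTo (suc L) = begin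
  suc (suc (length (extend (wordsUpTo L))))    ≡⟨ cong (2 +_) (length-extend (wordsUpTo L)) ⟩
  suc (suc (l + l))                            ≡⟨ cong suc (+-suc l l) ⟨
  suc l + suc l                                ≤⟨ +-mono-≤ (length-wordsUpTo L) (length-wordsUpTo L) ⟩
  2 ^ suc L + 2 ^ suc L                        ≡⟨ cong (2 ^ suc L +_) (+-identityʳ (2 ^ suc L)) ⟨
  2 ^ suc (suc L)                              ∎
  where
  open ≤-Reasoning
  l : ℕ
  l = length (wordsUpTo L)

length-cartesianProduct : ∀ {A B : Set} (xs : List A) (ys : List B) →
                          length (cartesianProduct xs ys) ≡ length xs * length ys
length-cartesianProduct []       ys = refl
length-cartesianProduct (x ∷ xs) ys = begin
  length (map (x ,_) ys ++ cartesianProduct xs ys)           ≡⟨ length-++ (map (x ,_) ys) ⟩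
  length (map (x ,_) ys) + length (cartesianProduct xs ys)   ≡⟨ cong₂ _+_ (length-map _ ys) (length-cartesianProduct xs ys) ⟩
  length ys + length xs * length ys                          ∎
  where open ≡-Reasoning

tri : ℕ → ℕ
tri zero    = 0
tri (suc j) = suc j + tri j

tri-mono : ∀ {j k} → j ≤ k → tri j ≤ tri k
tri-mono {zero}          _         = z≤n
tri-mono {suc j} {suc k} (s≤s j≤k) = +-mono-≤ (s≤s j≤k) (tri-mono j≤k)

tri-reflects-< : ∀ {j k} → tri j < tri k → j < k
tri-reflects-< lt = ≰⇒> (λ k≤j → <⇒≱ lt (tri-mono k≤j))

n≤tri : ∀ n → n ≤ tri n
n≤tri zero    = z≤n
n≤tri (suc n) = m≤m+n (suc n) (tri n)

tri≤square : ∀ m → tri m ≤ m * m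
tri≤square zero    = z≤n
tri≤square (suc m) = +-monoʳ-≤ (suc m) (≤-trans (tri≤square m) (*-monoʳ-≤ m (n≤1+n m)))

tri-double : ∀ s → 2 * tri s ≡ s * suc s
tri-double zero    = refl
tri-double (suc s) = begin
  2 * (suc s + tri s)        ≡⟨ *-distribˡ-+ 2 (suc s) (tri s) ⟩
  2 * suc s + 2 * tri s      ≡⟨ cong (2 * suc s +_) (tri-double s) ⟩
  2 * suc s + s * suc s      ≡⟨ *-distribʳ-+ (suc s) 2 s ⟨
  (2 + s) * suc s            ≡⟨ *-comm (2 + s) (suc s) ⟩
  suc s * suc (suc s)        ∎
  where open ≡-Reasoning

tri-superadditive : ∀ a b → tri a + tri b ≤ tri (a + b)
tri-superadditive zero    b = ≤-refl
tri-superadditive (suc a) b = begin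
  suc a + tri a + tri b      ≡⟨ +-assoc (suc a) (tri a) (tri b) ⟩
  suc a + (tri a + tri b)    ≤⟨ +-mono-≤ (s≤s (m≤m+n a b)) (tri-superadditive a b) ⟩
  suc (a + b) + tri (a + b)  ∎
  where open ≤-Reasoning

n<2^n : ∀ k → k < 2 ^ k
n<2^n zero    = s≤s z≤n
n<2^n (suc k) = begin-strict
  suc k          ≡⟨ +-comm 1 k ⟩
  k + 1          <⟨ +-mono-<-≤ (n<2^n k) (m^n>0 2 k) ⟩
  2 ^ k + 2 ^ k  ≡⟨ cong (2 ^ k +_) (+-identityʳ (2 ^ k)) ⟨
  2 ^ suc k      ∎
  where open ≤-Reasoning

square≤4^ : ∀ k → suc k * suc k ≤ 2 ^ (k + k)
square≤4^ k = begin
  suc k * suc k    ≤⟨ *-mono-≤ (n<2^n k) (n<2^n k) ⟩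
  2 ^ k * 2 ^ k    ≡⟨ ^-distribˡ-+-* 2 k k ⟨
  2 ^ (k + k)      ∎
  where open ≤-Reasoning

tri-power : ∀ m d → tri m ^ d ≤ m ^ (d + d)
tri-power m zero    = ≤-refl
tri-power m (suc d) = begin
  tri m * tri m ^ d          ≤⟨ *-mono-≤ (tri≤square m) (tri-power m d) ⟩
  m * m * m ^ (d + d)        ≡⟨ *-assoc m m (m ^ (d + d)) ⟩
  m ^ suc (suc (d + d))      ≡⟨ cong (λ e → m ^ suc e) (+-suc d d) ⟨
  m ^ (suc d + suc d)        ∎
  where open ≤-Reasoning

poly<exp : ∀ C d N → ∃[ m ] (N ≤ m × C * m ^ d < 2 ^ m)
poly<exp C d N = m , N≤m , bound
  where
  i k m : ℕ
  i = suc (C + (d + d) + N)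
  k = i + i
  m = 2 ^ k
  N≤m : N ≤ m
  N≤m = ≤-trans (m≤n+m N (C + (d + d)))
          (≤-trans (n≤1+n _) (≤-trans (m≤m+n i i) (<⇒≤ (n<2^n k))))
  exponent : C + k * d < 2 ^ k
  exponent = begin-strict
    C + k * d              ≡⟨ rearrange i C d ⟩
    C + i * (d + d)        ≤⟨ +-monoˡ-≤ (i * (d + d)) (m≤n*m C i) ⟩
    i * C + i * (d + d)    ≡⟨ *-distribˡ-+ i C (d + d) ⟨
    i * (C + (d + d))      ≤⟨ *-monoʳ-≤ i (≤-trans (m≤m+n (C + (d + d)) N) (n≤1+n _)) ⟩
    i * i                  <⟨ *-mono-< (n<1+n i) (n<1+n i) ⟩
    suc i * suc i          ≤⟨ square≤4^ i ⟩
    2 ^ k                  ∎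
    where
    open ≤-Reasoning
    rearrange : ∀ i C d → C + (i + i) * d ≡ C + i * (d + d)
    rearrange = solve-∀
  bound : C * m ^ d < 2 ^ m
  bound = begin-strict
    C * m ^ d              ≤⟨ *-monoˡ-≤ (m ^ d) (<⇒≤ (n<2^n C)) ⟩
    2 ^ C * (2 ^ k) ^ d    ≡⟨ cong (2 ^ C *_) (^-*-assoc 2 k d) ⟩
    2 ^ C * 2 ^ (k * d)    ≡⟨ ^-distribˡ-+-* 2 C (k * d) ⟨
    2 ^ (C + k * d)        <⟨ ^-monoʳ-< 2 (s≤s (s≤s z≤n)) exponent ⟩
    2 ^ m                  ∎
    where open ≤-Reasoning

linear<tri : ∀ a N → ∃[ s ] (N ≤ s × suc (4 * s) * a < tri s)
linear<tri a N = s , N≤s , *-cancelˡ-< 2 _ _ doubled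
  where
  s : ℕ
  s = suc (10 * a + N)
  N≤s : N ≤ s
  N≤s = ≤-trans (m≤n+m N (10 * a)) (n≤1+n _)
  doubled : 2 * (suc (4 * s) * a) < 2 * tri s
  doubled = begin-strict
    2 * (suc (4 * s) * a)    ≡⟨ expand s a ⟩
    (8 * s + 2) * a          ≤⟨ *-monoˡ-≤ a (+-monoʳ-≤ (8 * s) (m≤m*n 2 s)) ⟩
    (8 * s + 2 * s) * a      ≡⟨ collect s a ⟩
    s * (10 * a)             <⟨ *-monoʳ-< s (≤-trans (s≤s (m≤m+n (10 * a) N)) (n≤1+n s)) ⟩
    s * suc s                ≡⟨ tri-double s ⟨
    2 * tri s                ∎
    where
    open ≤-Reasoning
    expand : ∀ s a → 2 * (suc (4 * s) * a) ≡ (8 * s + 2) * a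
    expand = solve-∀
    collect : ∀ s a → (8 * s + 2 * s) * a ≡ s * (10 * a)
    collect = solve-∀

suc-2tri≤4^ : ∀ s → suc (tri s + tri s) ≤ 2 ^ (s + s)
suc-2tri≤4^ s = begin
  suc (tri s + tri s)      ≡⟨ cong (λ t → suc (tri s + t)) (+-identityʳ (tri s)) ⟨
  suc (2 * tri s)          ≡⟨ cong suc (tri-double s) ⟩
  suc (s * suc s)          ≤⟨ s≤s (m≤n+m (s * suc s) s) ⟩
  suc s * suc s            ≤⟨ square≤4^ s ⟩
  2 ^ (s + s)              ∎
  where open ≤-Reasoning

ball-count : ∀ s → suc (tri s + tri s) * length (wordsUpTo (s + s)) ≤ 2 ^ suc (4 * s)
ball-count s = begin
  suc (tri s + tri s) * length (wordsUpTo (s + s))  ≤⟨ *-mono-≤ (suc-2tri≤4^ s) (<⇒≤ (length-wordsUpTo (s + s))) ⟩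
  2 ^ (s + s) * 2 ^ suc (s + s)                     ≡⟨ ^-distribˡ-+-* 2 (s + s) (suc (s + s)) ⟨
  2 ^ (s + s + suc (s + s))                         ≡⟨ cong (2 ^_) (exponent s) ⟩
  2 ^ suc (4 * s)                                   ∎
  where
  open ≤-Reasoning
  exponent : ∀ s → s + s + suc (s + s) ≡ suc (4 * s)
  exponent = solve-∀

-- The trivial part of g'(tri s), namely tri s itself, is also below 2^(4s+1).
tri≤2^ : ∀ s → tri s ≤ 2 ^ suc (4 * s)
tri≤2^ s = begin
  tri s                ≤⟨ m≤m+n (tri s) (tri s) ⟩
  tri s + tri s        <⟨ suc-2tri≤4^ s ⟩
  2 ^ (s + s)          ≤⟨ ^-monoʳ-≤ 2 (≤-trans (exponent-≤ s) (n≤1+n _)) ⟩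
  2 ^ suc (4 * s)      ∎
  where
  open ≤-Reasoning
  exponent-≤ : ∀ s → s + s ≤ 4 * s
  exponent-≤ s = ≤-trans (m≤m+n (s + s) (s + s)) (≤-reflexive (four s))
    where
    four : ∀ s → s + s + (s + s) ≡ 4 * s
    four = solve-∀

power-gap : ∀ s c x → suc (4 * s) * suc c < tri s → x ≤ 2 ^ suc (4 * s) → ¬ (2 ^ tri s ≤ x ^ suc c)
power-gap s c x small x≤ big = <⇒≱ (^-monoʳ-< 2 (s≤s (s≤s z≤n)) small) (begin
  2 ^ tri s                   ≤⟨ big ⟩
  x ^ suc c                   ≤⟨ ^-monoˡ-≤ (suc c) x≤ ⟩
  (2 ^ suc (4 * s)) ^ suc c   ≡⟨ ^-*-assoc 2 (suc (4 * s)) (suc c) ⟩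
  2 ^ (suc (4 * s) * suc c)   ∎)
  where open ≤-Reasoning

length-snoc : ∀ {A : Set} (w : List A) z → length (w ++ [ z ]) ≡ suc (length w)
length-snoc w z = trans (length-++ w) (+-comm (length w) 1)

take-++ˡ : ∀ {A : Set} n (xs ys : List A) → n ≤ length xs → take n (xs ++ ys) ≡ take n xs
take-++ˡ zero    xs       ys _         = refl
take-++ˡ (suc n) (x ∷ xs) ys (s≤s n≤l) = cong (x ∷_) (take-++ˡ n xs ys n≤l)

-- The cursor graph.  A node is a word together with a cursor position; the
-- nodes that matter are the valid ones, with the cursor inside the word.
Node : Set
Node = List Bool × ℕ

word : Node → List Bool
word = proj₁

data _⟶_ : Node → Node → Set where
  move : ∀ {w p} → suc p < length w → (w , p) ⟶ (w , suc p)
  grow : ∀ {b w} z → (b ∷ w , length w) ⟶ (b ∷ w ++ [ z ] , 0)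

Valid : Node → Set
Valid (w , p) = p < length w

step-valid : ∀ {x y} → x ⟶ y → Valid x × Valid y
step-valid (move lt)          = <-trans (n<1+n _) lt , lt
step-valid (grow {w = w} z)   = n<1+n (length w) , s≤s z≤n

-- Levels of length 1, 2, 3, ... are traversed one after the other, so the
-- number of steps from the root to (w , p) is tri (|w| - 1) + p.
depth : Node → ℕ
depth (w , p) = tri (pred (length w)) + p

step-depth : ∀ {x y} → x ⟶ y → depth y ≡ suc (depth x)
step-depth (move {w} {p} _) = +-suc (tri (pred (length w))) p
step-depth (grow {w = w} z) = begin
  tri (length (w ++ [ z ])) + 0     ≡⟨ +-identityʳ _ ⟩
  tri (length (w ++ [ z ]))         ≡⟨ cong tri (length-snoc w z) ⟩
  suc (length w + tri (length w))   ≡⟨ cong suc (+-comm (length w) _) ⟩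
  suc (tri (length w) + length w)   ∎
  where open ≡-Reasoning

step-deepens : ∀ {x y} → x ⟶ y → depth x ≤ depth y
step-deepens x⟶y = ≤-trans (n≤1+n _) (≤-reflexive (sym (step-depth x⟶y)))

-- A step starting at depth ≥ tri j keeps the first j + 1 letters, since
-- the word then already has at least j + 1 letters.
step-prefix : ∀ {x y} j → x ⟶ y → tri j ≤ depth x → take (suc j) (word x) ≡ take (suc j) (word y)
step-prefix j (move _)             _  = refl
step-prefix j (grow {b} {w} z)     le = cong (b ∷_) (sym (take-++ˡ j w [ z ] j≤l))
  where
  j≤l : j ≤ length w
  j≤l = s≤s⁻¹ (tri-reflects-< (s≤s (≤-trans le (≤-reflexive (+-comm (tri (length w)) (length w))))))

Linked : Node → Node → Set
Linked x y = x ⟶ y ⊎ y ⟶ x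

linked-depth : ∀ {x y} → Linked x y → depth y ≤ suc (depth x) × depth x ≤ suc (depth y)
linked-depth (inj₁ x⟶y) = ≤-reflexive (step-depth x⟶y) , m≤n⇒m≤1+n (step-deepens x⟶y)
linked-depth (inj₂ y⟶x) = m≤n⇒m≤1+n (step-deepens y⟶x) , ≤-reflexive (step-depth y⟶x)

linked-prefix : ∀ {x y} j → Linked x y → tri j ≤ depth x → tri j ≤ depth y →
                take (suc j) (word x) ≡ take (suc j) (word y)
linked-prefix j (inj₁ x⟶y) lex _   = step-prefix j x⟶y lex
linked-prefix j (inj₂ y⟶x) _   ley = sym (step-prefix j y⟶x ley)

data Walk : ℕ → Node → Node → Set where
  stay : ∀ {n x} → Walk n x x
  link : ∀ {n x y z} → Linked x y → Walk n y z → Walk (suc n) x z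

walk-depth : ∀ {n x y} → Walk n x y → depth y ≤ depth x + n × depth x ≤ depth y + n
walk-depth {n} stay = m≤m+n _ n , m≤m+n _ n
walk-depth {suc n} {x} {y} (link {y = c} l w) = up , down
  where
  open ≤-Reasoning
  up : depth y ≤ depth x + suc n
  up = begin
    depth y              ≤⟨ proj₁ (walk-depth w) ⟩
    depth c + n          ≤⟨ +-monoˡ-≤ n (proj₁ (linked-depth l)) ⟩
    suc (depth x) + n    ≡⟨ +-suc (depth x) n ⟨
    depth x + suc n      ∎
  down : depth x ≤ depth y + suc n
  down = begin
    depth x              ≤⟨ proj₂ (linked-depth l) ⟩
    suc (depth c)        ≤⟨ s≤s (proj₂ (walk-depth w)) ⟩
    suc (depth y + n)    ≡⟨ +-suc (depth y) n ⟨
    depth y + suc n      ∎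

walk-prefix : ∀ {n x y} j → Walk n x y → tri j + n ≤ depth x →
              take (suc j) (word x) ≡ take (suc j) (word y)
walk-prefix j stay _ = refl
walk-prefix {suc n} {x} j (link {y = c} l w) le =
  trans (linked-prefix j l (≤-trans (m≤m+n (tri j) (suc n)) le) (≤-trans (m≤m+n (tri j) n) le′))
        (walk-prefix j w le′)
  where
  le′ : tri j + n ≤ depth c
  le′ = s≤s⁻¹ (begin
    suc (tri j + n)      ≡⟨ +-suc (tri j) n ⟨
    tri j + suc n        ≤⟨ le ⟩
    depth x              ≤⟨ proj₂ (linked-depth l) ⟩
    suc (depth c)        ∎)
    where open ≤-Reasoning

path-walk : ∀ {x y} → Star _⟶_ x y → ∃[ k ] (Walk k x y × depth y ≡ k + depth x)
path-walk ε = 0 , stay , refl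
path-walk {x} (x⟶c ◅ path) with path-walk path
... | k , w , eq = suc k , link (inj₁ x⟶c) w , trans eq (trans (cong (k +_) (step-depth x⟶c)) (+-suc k (depth x)))

sweep : ∀ w p → p < length w → Star _⟶_ (w , 0) (w , p)
sweep w zero    _  = ε
sweep w (suc p) lt = sweep w p (<-trans (n<1+n p) lt) ◅◅ (move lt ◅ ε)

descend : ∀ b w s → Star _⟶_ (b ∷ w , 0) (b ∷ w ++ s , 0)
descend b w []      = subst (λ v → Star _⟶_ (b ∷ w , 0) (b ∷ v , 0)) (sym (++-identityʳ w)) ε
descend b w (z ∷ s) =
  sweep (b ∷ w) (length w) (n<1+n (length w)) ◅◅ grow z ◅
  subst (λ v → Star _⟶_ (b ∷ w ++ [ z ] , 0) (b ∷ v , 0)) (++-assoc w [ z ] s) (descend b (w ++ [ z ]) s)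

≤-suc-pred : ∀ l → l ≤ suc (pred l)
≤-suc-pred zero    = z≤n
≤-suc-pred (suc l) = ≤-refl

node-ext : ∀ {x y} → word x ≡ word y → depth x ≡ depth y → x ≡ y
node-ext {w , p} {.w , q} refl eq = cong (w ,_) (+-cancelˡ-≡ (tri (pred (length w))) p q eq)

-- The ball of radius tri s around a node x.  Its nodes agree with x on
-- the first K letters, where K is the first level with depth x < tri K + n.
module NodeBall (x : Node) (s : ℕ) where

  n : ℕ
  n = tri s

  -- Below the shared prefix, words of the ball have at most L letters.
  L : ℕ
  L = s + s

  cut : ∃[ K ] (depth x < tri K + n × (K ≡ 0 ⊎ ∃[ j ] (K ≡ suc j × ¬ (depth x < tri j + n))))
  cut = first-crossing (λ K → depth x <? tri K + n) (suc (depth x))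
          (≤-trans (n≤tri (suc (depth x))) (m≤m+n _ n))

  K : ℕ
  K = proj₁ cut

  -- The first K letters are too high up for a walk of length n to reach.
  shared-prefix : ∀ {y} → Walk n x y → take K (word y) ≡ take K (word x)
  shared-prefix w with proj₂ (proj₂ cut)
  ... | inj₁ K≡0               rewrite K≡0 = refl
  ... | inj₂ (j , K≡1+j , ¬lt) rewrite K≡1+j = sym (walk-prefix j w (≮⇒≥ ¬lt))

  word-bound : ∀ {y} → Walk n x y → length (word y) ≤ K + L
  word-bound {y} w = ≤-trans (≤-suc-pred (length (word y))) (tri-reflects-< deep)
    where
    open ≤-Reasoning
    deep : tri (pred (length (word y))) < tri (K + L)
    deep = begin-strict
      tri (pred (length (word y)))   ≤⟨ m≤m+n _ (proj₂ y) ⟩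
      depth y                        ≤⟨ proj₁ (walk-depth w) ⟩
      depth x + n                    <⟨ +-monoˡ-< n (proj₁ (proj₂ cut)) ⟩
      tri K + n + n                  ≡⟨ +-assoc (tri K) n n ⟩
      tri K + (n + n)                ≤⟨ +-monoʳ-≤ (tri K) (tri-superadditive s s) ⟩
      tri K + tri L                  ≤⟨ tri-superadditive K L ⟩
      tri (K + L)                    ∎

  -- All depths in the ball lie in [lowest, lowest + 2n].
  lowest : ℕ
  lowest = depth x ∸ n

  lowest≤ : ∀ {y} → Walk n x y → lowest ≤ depth y
  lowest≤ {y} w = m≤n+o⇒m∸n≤o (depth x) n (≤-trans (proj₂ (walk-depth w)) (≤-reflexive (+-comm (depth y) n)))

  -- A node of the ball is coded by its depth offset and its word without
  -- the shared prefix; the codes range over a list of (2n + 1)·|wordsUpTo L|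
  -- candidates, and distinct nodes of the ball have distinct codes.
  code : Node → ℕ × List Bool
  code y = depth y ∸ lowest , drop K (word y)

  codes : List (ℕ × List Bool)
  codes = cartesianProduct (upTo (suc (n + n))) (wordsUpTo L)

  code∈codes : ∀ {y} → Walk n x y → code y ∈ codes
  code∈codes {y} w = ∈-cartesianProduct⁺ (∈-upTo⁺ (s≤s offset)) (∈-wordsUpTo L _ suffix)
    where
    open ≤-Reasoning
    offset : depth y ∸ lowest ≤ n + n
    offset = m≤n+o⇒m∸n≤o (depth y) lowest (begin
      depth y                  ≤⟨ proj₁ (walk-depth w) ⟩
      depth x + n              ≤⟨ +-monoˡ-≤ n (m≤n+m∸n (depth x) n) ⟩
      n + lowest + n           ≡⟨ cong (_+ n) (+-comm n lowest) ⟩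
      lowest + n + n           ≡⟨ +-assoc lowest n n ⟩
      lowest + (n + n)         ∎)
    suffix : length (drop K (word y)) ≤ L
    suffix = begin
      length (drop K (word y)) ≡⟨ length-drop K (word y) ⟩
      length (word y) ∸ K      ≤⟨ m≤n+o⇒m∸n≤o (length (word y)) K (word-bound w) ⟩
      L                        ∎

  code-injective : ∀ {y y′} → Walk n x y → Walk n x y′ → code y ≡ code y′ → y ≡ y′
  code-injective {y} {y′} w w′ eq = node-ext same-word same-depth
    where
    open ≡-Reasoning
    same-word : word y ≡ word y′
    same-word = begin
      word y                              ≡⟨ take++drop≡id K (word y) ⟨
      take K (word y) ++ drop K (word y)  ≡⟨ cong₂ _++_ (trans (shared-prefix w) (sym (shared-prefix w′))) (cong proj₂ eq) ⟩
      take K (word y′) ++ drop K (word y′) ≡⟨ take++drop≡id K (word y′) ⟩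
      word y′                             ∎
    same-depth : depth y ≡ depth y′
    same-depth = ∸-cancelʳ-≡ (lowest≤ w) (lowest≤ w′) (cong proj₁ eq)

  length-codes : length codes ≡ suc (n + n) * length (wordsUpTo L)
  length-codes = trans (length-cartesianProduct (upTo (suc (n + n))) (wordsUpTo L))
                       (cong (_* length (wordsUpTo L)) (length-applyUpTo (λ i → i) (suc (n + n))))

universal : {A : Set} → DFA A
universal = record { states = 1 ; start = zero ; δ = λ q _ → q ; accept = λ _ → true }

-- The diagonal automaton: it accepts the convolution of u and v iff u ≡ v.
-- State 0 means "equal so far", state 1 is a rejecting sink.
module _ {A : Set} (_≟A_ : DecidableEquality A) where

  diagonal-step : Fin 2 → Maybe A × Maybe A → Fin 2
  diagonal-step zero (just x , just y) = if does (x ≟A y) then zero else suc zero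
  diagonal-step _    _                 = suc zero

  diagonal : DFA (Maybe A × Maybe A)
  diagonal = record { states = 2 ; start = zero ; δ = diagonal-step ; accept = λ { zero → true ; (suc _) → false } }

  private
    sink-rejects : ∀ w → ¬ DFA.accept diagonal (foldl diagonal-step (suc zero) w) ≡ true
    sink-rejects []      ()
    sink-rejects (_ ∷ w) = sink-rejects w

  diagonal-sound : ∀ u v → Rel2 diagonal u v → u ≡ v
  diagonal-sound []      []      _ = refl
  diagonal-sound []      (_ ∷ v) h = ⊥-elim (sink-rejects (conv [] v) h)
  diagonal-sound (_ ∷ u) []      h = ⊥-elim (sink-rejects (conv u []) h)
  diagonal-sound (x ∷ u) (y ∷ v) h with x ≟A y
  ... | yes refl = cong (x ∷_) (diagonal-sound u v h)
  ... | no  _    = ⊥-elim (sink-rejects (conv u v) h)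

  diagonal-complete : ∀ u → Rel2 diagonal u u
  diagonal-complete []      = refl
  diagonal-complete (x ∷ u) with x ≟A x
  ... | yes _  = diagonal-complete u
  ... | no x≢x = ⊥-elim (x≢x refl)

diagonal-congruence : ∀ k (domA : DFA (Fin k)) (edgA : DFA (Maybe (Fin k) × Maybe (Fin k))) →
  IsCongruence (record { k = k ; domA = domA ; edgA = edgA ; eqvA = diagonal _≟_ })
diagonal-congruence k domA edgA = record
  { refl′  = λ (u , _) → diagonal-complete _≟_ u
  ; sym′   = λ {(u , _)} {(v , _)} h → same (sym (diagonal-sound _≟_ u v h))
  ; trans′ = λ {(u , _)} {(v , _)} {(w , _)} h h′ →
               same (trans (diagonal-sound _≟_ u v h) (diagonal-sound _≟_ v w h′))
  ; compat = λ {(u , _)} {(u′ , _)} {(v , _)} {(v′ , _)} h h′ →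
               subst₂ (Rel2 edgA) (diagonal-sound _≟_ u u′ h) (diagonal-sound _≟_ v v′ h′)
  }
  where
  same : ∀ {u v} → u ≡ v → Rel2 (diagonal _≟_) u v
  same {u} refl = diagonal-complete _≟_ u

-- Letters carry a bit of the word and a flag marking the cursor position.
Letter : Set
Letter = Fin 4

letter : Bool → Bool → Letter
letter false false = zero
letter true  false = suc zero
letter false true  = suc (suc zero)
letter true  true  = suc (suc (suc zero))

bitOf : Letter → Bool
bitOf zero                = false
bitOf (suc zero)          = true
bitOf (suc (suc zero))    = false
bitOf (suc (suc (suc _))) = true

flagOf : Letter → Bool
flagOf zero                = false
flagOf (suc zero)          = false
flagOf (suc (suc zero))    = true
flagOf (suc (suc (suc _))) = true

bitOf-letter : ∀ b c → bitOf (letter b c) ≡ b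
bitOf-letter false false = refl
bitOf-letter true  false = refl
bitOf-letter false true  = refl
bitOf-letter true  true  = refl

letter-of : ∀ x {b c} → bitOf x ≡ b → flagOf x ≡ c → x ≡ letter b c
letter-of zero                      refl refl = refl
letter-of (suc zero)                refl refl = refl
letter-of (suc (suc zero))          refl refl = refl
letter-of (suc (suc (suc zero)))    refl refl = refl

Str : Set
Str = List Letter

plain : List Bool → Str
plain = map (λ b → letter b false)

mark : List Bool → ℕ → Str
mark []      _       = []
mark (b ∷ w) zero    = letter b true  ∷ plain w
mark (b ∷ w) (suc p) = letter b false ∷ mark w p

enc : Node → Str
enc (w , p) = mark w p

cursorOf : Str → ℕ
cursorOf []      = 0
cursorOf (c ∷ u) = if flagOf c then 0 else suc (cursorOf u)

decode : Str → Node
decode u = map bitOf u , cursorOf u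

bits-plain : ∀ w → map bitOf (plain w) ≡ w
bits-plain []      = refl
bits-plain (b ∷ w) = cong₂ List._∷_ (bitOf-letter b false) (bits-plain w)

bits-mark : ∀ w p → map bitOf (mark w p) ≡ w
bits-mark []      _       = refl
bits-mark (b ∷ w) zero    = cong₂ List._∷_ (bitOf-letter b true) (bits-plain w)
bits-mark (b ∷ w) (suc p) = cong₂ List._∷_ (bitOf-letter b false) (bits-mark w p)

cursor-mark : ∀ w p → p < length w → cursorOf (mark w p) ≡ p
cursor-mark (false ∷ w) zero    _         = refl
cursor-mark (true  ∷ w) zero    _         = refl
cursor-mark (false ∷ w) (suc p) (s≤s p<l) = cong suc (cursor-mark w p p<l)
cursor-mark (true  ∷ w) (suc p) (s≤s p<l) = cong suc (cursor-mark w p p<l)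

decode-enc : ∀ {x} → Valid x → decode (enc x) ≡ x
decode-enc {w , p} p<l = cong₂ _,_ (bits-mark w p) (cursor-mark w p p<l)

Canonical : Str → Set
Canonical u = enc (decode u) ≡ u

enc-canonical : ∀ {x} → Valid x → Canonical (enc x)
enc-canonical {x} valid = cong enc (decode-enc {x} valid)

-- The edge automaton reads the convolution of enc x and enc y and checks
-- x ⟶ y: both words agree bitwise, and either the cursor moves one place
-- to the right (states move₀ → move₁ → move₂), or the source cursor is on
-- the last letter and the target has one more letter with the cursor in
-- front (states grow₁ → grow₂ → grow₃).
State : Set
State = Fin 8

pattern init  = zero
pattern move₀ = suc zero
pattern move₁ = suc (suc zero)
pattern move₂ = suc (suc (suc zero))
pattern grow₁ = suc (suc (suc (suc zero)))
pattern grow₂ = suc (suc (suc (suc (suc zero))))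
pattern grow₃ = suc (suc (suc (suc (suc (suc zero)))))
pattern dead  = suc (suc (suc (suc (suc (suc (suc zero))))))

on-flags : State → Bool → Bool → State
on-flags init  false false = move₀
on-flags init  true  false = move₁
on-flags init  false true  = grow₁
on-flags init  true  true  = grow₂
on-flags move₀ false false = move₀
on-flags move₀ true  false = move₁
on-flags move₁ false true  = move₂
on-flags move₂ false false = move₂
on-flags grow₁ false false = grow₁
on-flags grow₁ true  false = grow₂
on-flags _     _     _     = dead

on-tail : State → Letter → State
on-tail grow₂ y = if flagOf y then dead else grow₃
on-tail _     _ = dead

edge-step : State → Maybe Letter × Maybe Letter → State
edge-step q (just x  , just y) = if does (bitOf x Bool.≟ bitOf y) then on-flags q (flagOf x) (flagOf y) else dead
edge-step q (nothing , just y) = on-tail q y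
edge-step _ _                  = dead

edge-accept : State → Bool
edge-accept move₂ = true
edge-accept grow₃ = true
edge-accept _     = false

edges : DFA (Maybe Letter × Maybe Letter)
edges = record { states = 8 ; start = init ; δ = edge-step ; accept = edge-accept }

Accepting : State → List (Maybe Letter × Maybe Letter) → Set
Accepting q i = edge-accept (foldl edge-step q i) ≡ true

AccFrom : State → Str → Str → Set
AccFrom q u v = Accepting q (conv u v)

dead-rejects : ∀ i → ¬ Accepting dead i
dead-rejects []                        ()
dead-rejects ((just x  , just y) ∷ i) h with does (bitOf x Bool.≟ bitOf y)
... | true  = dead-rejects i h
... | false = dead-rejects i h
dead-rejects ((just _  , nothing) ∷ i) h = dead-rejects i h
dead-rejects ((nothing , just _)  ∷ i) h = dead-rejects i h
dead-rejects ((nothing , nothing) ∷ i) h = dead-rejects i h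

read-pair : ∀ q x y u v → AccFrom q (x ∷ u) (y ∷ v) →
            bitOf x ≡ bitOf y × AccFrom (on-flags q (flagOf x) (flagOf y)) u v
read-pair q x y u v = by-bits (bitOf x Bool.≟ bitOf y)
  where
  by-bits : (d : Dec (bitOf x ≡ bitOf y)) →
            Accepting (if does d then on-flags q (flagOf x) (flagOf y) else dead) (conv u v) →
            bitOf x ≡ bitOf y × AccFrom (on-flags q (flagOf x) (flagOf y)) u v
  by-bits (yes same) h = same , h
  by-bits (no _)     h = ⊥-elim (dead-rejects (conv u v) h)

∷-letter : ∀ x {b c u u′} → bitOf x ≡ b → flagOf x ≡ c → u ≡ u′ → x ∷ u ≡ letter b c ∷ u′
∷-letter x bx fx u≡ = cong₂ List._∷_ (letter-of x bx fx) u≡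

from-move₂ : ∀ u v → AccFrom move₂ u v → ∃[ w ] (u ≡ plain w × v ≡ plain w)
from-move₂ []      []      _ = [] , refl , refl
from-move₂ []      (_ ∷ v) h = ⊥-elim (dead-rejects (conv [] v) h)
from-move₂ (_ ∷ u) []      h = ⊥-elim (dead-rejects (conv u []) h)
from-move₂ (x ∷ u) (y ∷ v) h with read-pair move₂ x y u v h
... | same , h′ with flagOf x in fx | flagOf y in fy
...   | false | false = let (w , u≡ , v≡) = from-move₂ u v h′
                        in bitOf x ∷ w , ∷-letter x refl fx u≡ , ∷-letter y (sym same) fy v≡
...   | false | true  = ⊥-elim (dead-rejects (conv u v) h′)
...   | true  | _     = ⊥-elim (dead-rejects (conv u v) h′)

from-move₁ : ∀ u v → AccFrom move₁ u v → ∃[ b ] ∃[ w ] (u ≡ plain (b ∷ w) × v ≡ mark (b ∷ w) 0)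
from-move₁ []      []      ()
from-move₁ []      (_ ∷ v) h = ⊥-elim (dead-rejects (conv [] v) h)
from-move₁ (_ ∷ u) []      h = ⊥-elim (dead-rejects (conv u []) h)
from-move₁ (x ∷ u) (y ∷ v) h with read-pair move₁ x y u v h
... | same , h′ with flagOf x in fx | flagOf y in fy
...   | false | true  = let (w , u≡ , v≡) = from-move₂ u v h′
                        in bitOf x , w , ∷-letter x refl fx u≡ , ∷-letter y (sym same) fy v≡
...   | false | false = ⊥-elim (dead-rejects (conv u v) h′)
...   | true  | _     = ⊥-elim (dead-rejects (conv u v) h′)

from-move₀ : ∀ u v → AccFrom move₀ u v →
             ∃[ w ] ∃[ p ] (suc p < length w × u ≡ mark w p × v ≡ mark w (suc p))
from-move₀ []      []      ()
from-move₀ []      (_ ∷ v) h = ⊥-elim (dead-rejects (conv [] v) h)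
from-move₀ (_ ∷ u) []      h = ⊥-elim (dead-rejects (conv u []) h)
from-move₀ (x ∷ u) (y ∷ v) h with read-pair move₀ x y u v h
... | same , h′ with flagOf x in fx | flagOf y in fy
...   | false | false = let (w , p , lt , u≡ , v≡) = from-move₀ u v h′
                        in bitOf x ∷ w , suc p , s≤s lt , ∷-letter x refl fx u≡ , ∷-letter y (sym same) fy v≡
...   | true  | false = let (b , w , u≡ , v≡) = from-move₁ u v h′
                        in bitOf x ∷ b ∷ w , 0 , s≤s (s≤s z≤n) , ∷-letter x refl fx u≡ , ∷-letter y (sym same) fy v≡
...   | false | true  = ⊥-elim (dead-rejects (conv u v) h′)
...   | true  | true  = ⊥-elim (dead-rejects (conv u v) h′)

from-grow₃ : ∀ u v → AccFrom grow₃ u v → u ≡ [] × v ≡ []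
from-grow₃ []      []      _ = refl , refl
from-grow₃ []      (_ ∷ v) h = ⊥-elim (dead-rejects (conv [] v) h)
from-grow₃ (_ ∷ u) []      h = ⊥-elim (dead-rejects (conv u []) h)
from-grow₃ (x ∷ u) (y ∷ v) h = ⊥-elim (dead-rejects (conv u v) (proj₂ (read-pair grow₃ x y u v h)))

from-grow₂ : ∀ u v → AccFrom grow₂ u v → u ≡ [] × ∃[ z ] v ≡ plain [ z ]
from-grow₂ []      []      ()
from-grow₂ []      (y ∷ v) h with flagOf y in fy
... | true  = ⊥-elim (dead-rejects (conv [] v) h)
... | false with from-grow₃ [] v h
...   | _ , refl = refl , bitOf y , ∷-letter y refl fy refl
from-grow₂ (_ ∷ u) []      h = ⊥-elim (dead-rejects (conv u []) h)
from-grow₂ (x ∷ u) (y ∷ v) h = ⊥-elim (dead-rejects (conv u v) (proj₂ (read-pair grow₂ x y u v h)))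

from-grow₁ : ∀ u v → AccFrom grow₁ u v →
             ∃[ b ] ∃[ w ] ∃[ z ] (u ≡ mark (b ∷ w) (length w) × v ≡ plain (b ∷ w ++ [ z ]))
from-grow₁ []      []      ()
from-grow₁ []      (_ ∷ v) h = ⊥-elim (dead-rejects (conv [] v) h)
from-grow₁ (_ ∷ u) []      h = ⊥-elim (dead-rejects (conv u []) h)
from-grow₁ (x ∷ u) (y ∷ v) h with read-pair grow₁ x y u v h
... | same , h′ with flagOf x in fx | flagOf y in fy
...   | false | false = let (b , w , z , u≡ , v≡) = from-grow₁ u v h′
                        in bitOf x , b ∷ w , z , ∷-letter x refl fx u≡ , ∷-letter y (sym same) fy v≡
...   | true  | false = let (u≡ , z , v≡) = from-grow₂ u v h′
                        in bitOf x , [] , z , ∷-letter x refl fx u≡ , ∷-letter y (sym same) fy v≡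
...   | false | true  = ⊥-elim (dead-rejects (conv u v) h′)
...   | true  | true  = ⊥-elim (dead-rejects (conv u v) h′)

edges-sound : ∀ u v → Rel2 edges u v → ∃[ x ] ∃[ y ] (x ⟶ y × u ≡ enc x × v ≡ enc y)
edges-sound []      []      ()
edges-sound []      (_ ∷ v) h = ⊥-elim (dead-rejects (conv [] v) h)
edges-sound (_ ∷ u) []      h = ⊥-elim (dead-rejects (conv u []) h)
edges-sound (x ∷ u) (y ∷ v) h with read-pair init x y u v h
... | same , h′ with flagOf x in fx | flagOf y in fy
...   | false | false = let (w , p , lt , u≡ , v≡) = from-move₀ u v h′
                        in (bitOf x ∷ w , suc p) , (bitOf x ∷ w , suc (suc p)) , move (s≤s lt) ,
                           ∷-letter x refl fx u≡ , ∷-letter y (sym same) fy v≡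
...   | true  | false = let (b , w , u≡ , v≡) = from-move₁ u v h′
                        in (bitOf x ∷ b ∷ w , 0) , (bitOf x ∷ b ∷ w , 1) , move (s≤s (s≤s z≤n)) ,
                           ∷-letter x refl fx u≡ , ∷-letter y (sym same) fy v≡
...   | false | true  = let (b , w , z , u≡ , v≡) = from-grow₁ u v h′
                        in (bitOf x ∷ b ∷ w , suc (length w)) , (bitOf x ∷ b ∷ w ++ [ z ] , 0) , grow z ,
                           ∷-letter x refl fx u≡ , ∷-letter y (sym same) fy v≡
...   | true  | true  = let (u≡ , z , v≡) = from-grow₂ u v h′
                        in (bitOf x ∷ [] , 0) , (bitOf x ∷ z ∷ [] , 0) , grow z ,
                           ∷-letter x refl fx u≡ , ∷-letter y (sym same) fy v≡

to-move₂ : ∀ w → AccFrom move₂ (plain w) (plain w)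
to-move₂ []          = refl
to-move₂ (false ∷ w) = to-move₂ w
to-move₂ (true  ∷ w) = to-move₂ w

to-move₁ : ∀ b w → AccFrom move₁ (plain (b ∷ w)) (mark (b ∷ w) 0)
to-move₁ false w = to-move₂ w
to-move₁ true  w = to-move₂ w

to-move₀ : ∀ w p → suc p < length w → AccFrom move₀ (mark w p) (mark w (suc p))
to-move₀ (false ∷ c ∷ w) zero    _        = to-move₁ c w
to-move₀ (true  ∷ c ∷ w) zero    _        = to-move₁ c w
to-move₀ (false ∷ w)     (suc p) (s≤s lt) = to-move₀ w p lt
to-move₀ (true  ∷ w)     (suc p) (s≤s lt) = to-move₀ w p lt

to-grow₂ : ∀ z → AccFrom grow₂ [] (plain [ z ])
to-grow₂ false = refl
to-grow₂ true  = refl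

to-grow₁ : ∀ b w z → AccFrom grow₁ (mark (b ∷ w) (length w)) (plain (b ∷ w ++ [ z ]))
to-grow₁ false []      z = to-grow₂ z
to-grow₁ true  []      z = to-grow₂ z
to-grow₁ false (c ∷ w) z = to-grow₁ c w z
to-grow₁ true  (c ∷ w) z = to-grow₁ c w z

edges-complete : ∀ {x y} → x ⟶ y → Rel2 edges (enc x) (enc y)
edges-complete (move {false ∷ c ∷ w} {zero}  _)        = to-move₁ c w
edges-complete (move {true  ∷ c ∷ w} {zero}  _)        = to-move₁ c w
edges-complete (move {_ ∷ []}        {zero}  (s≤s ()))
edges-complete (move {false ∷ w}     {suc p} (s≤s lt)) = to-move₀ w p lt
edges-complete (move {true  ∷ w}     {suc p} (s≤s lt)) = to-move₀ w p lt
edges-complete (grow {false} {[]}    z)                = to-grow₂ z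
edges-complete (grow {true}  {[]}    z)                = to-grow₂ z
edges-complete (grow {false} {c ∷ w} z)                = to-grow₁ c w z
edges-complete (grow {true}  {c ∷ w} z)                = to-grow₁ c w z

P : AutoPres
P = record { k = 4 ; domA = universal ; edgA = edges ; eqvA = diagonal _≟_ }

congruence : IsCongruence P
congruence = diagonal-congruence 4 universal edges

open AutoPres P using (Elt; E; _≈_)

elt : Node → Elt
elt x = enc x , refl

≈⇒≡ : ∀ {a b : Elt} → a ≈ b → proj₁ a ≡ proj₁ b
≈⇒≡ {a} {b} = diagonal-sound _≟_ (proj₁ a) (proj₁ b)

≡⇒≈ : ∀ {a b : Elt} → proj₁ a ≡ proj₁ b → a ≈ b
≡⇒≈ {a} refl = diagonal-complete _≟_ (proj₁ a)

canonical-injective : ∀ {u v} → Canonical u → Canonical v → decode u ≡ decode v → u ≡ v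
canonical-injective cu cv eq = trans (sym cu) (trans (cong enc eq) cv)

edge-node-step : ∀ {a b : Elt} → E a b →
                 Canonical (proj₁ a) × Canonical (proj₁ b) × decode (proj₁ a) ⟶ decode (proj₁ b)
edge-node-step {u , _} {v , _} e with edges-sound u v e
... | x , y , x⟶y , refl , refl =
  enc-canonical {x} vx , enc-canonical {y} vy , subst₂ _⟶_ (sym (decode-enc {x} vx)) (sym (decode-enc {y} vy)) x⟶y
  where
  vx : Valid x
  vx = proj₁ (step-valid x⟶y)
  vy : Valid y
  vy = proj₂ (step-valid x⟶y)

adjacent-linked : ∀ {a b : Elt} → Adj P a b →
                  Canonical (proj₁ a) × Canonical (proj₁ b) × Linked (decode (proj₁ a)) (decode (proj₁ b))
adjacent-linked {a} {b} (inj₁ e) = let (ca , cb , s) = edge-node-step {a} {b} e in ca , cb , inj₁ s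
adjacent-linked {a} {b} (inj₂ e) = let (cb , ca , s) = edge-node-step {b} {a} e in ca , cb , inj₂ s

within-walk : ∀ {n} {a b : Elt} → Canonical (proj₁ a) → Within P n a b →
              Canonical (proj₁ b) × Walk n (decode (proj₁ a)) (decode (proj₁ b))
within-walk {n} {a} {b} ca (here h) =
  subst (λ v → Canonical v × Walk n (decode (proj₁ a)) (decode v)) (≈⇒≡ {a} {b} h) (ca , stay)
within-walk {a = a} ca (step {c = c} adj w) =
  let (_ , cc , l) = adjacent-linked {a} {c} adj ; (cb , w′) = within-walk {a = c} cc w in cb , link l w′

-- A non-canonical string is an isolated vertex.
isolated : ∀ {n} {a b : Elt} → ¬ Canonical (proj₁ a) → Within P n a b → proj₁ b ≡ proj₁ a
isolated {a = a} {b} _   (here h)              = sym (≈⇒≡ {a} {b} h)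
isolated {a = a}     nca (step {c = c} adj _)  = ⊥-elim (nca (proj₁ (adjacent-linked {a} {c} adj)))

walk-within : ∀ {n x y} → Walk n x y → Within P n (elt x) (elt y)
walk-within {x = x} stay      = here (diagonal-complete _≟_ (enc x))
walk-within (link (inj₁ s) w) = step (inj₁ (edges-complete s)) (walk-within w)
walk-within (link (inj₂ s) w) = step (inj₂ (edges-complete s)) (walk-within w)

parent : Node → Node
parent (v , _) = take (pred (length v)) v , pred (pred (length v))

grow-parent : ∀ b w z → parent (b ∷ w ++ [ z ] , 0) ≡ (b ∷ w , length w)
grow-parent b w z = cong₂ _,_ word-eq (cong pred (length-snoc w z))
  where
  open ≡-Reasoning
  word-eq : take (length (w ++ [ z ])) (b ∷ w ++ [ z ]) ≡ b ∷ w
  word-eq = begin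
    take (length (w ++ [ z ])) (b ∷ w ++ [ z ])  ≡⟨ cong (λ k → take k (b ∷ w ++ [ z ])) (length-snoc w z) ⟩
    b ∷ take (length w) (w ++ [ z ])             ≡⟨ cong (b ∷_) (take-++ˡ (length w) w [ z ] ≤-refl) ⟩
    b ∷ take (length w) w                        ≡⟨ cong (b ∷_) (take-all (length w) w ≤-refl) ⟩
    b ∷ w                                        ∎

neighbours : Node → List Node
neighbours (w , p) = (w , suc p) ∷ (w ++ [ false ] , 0) ∷ (w ++ [ true ] , 0) ∷ (w , pred p) ∷ parent (w , p) ∷ []

linked-neighbour : ∀ {x y} → Linked x y → y ∈ neighbours x
linked-neighbour (inj₁ (move _))           = here refl
linked-neighbour (inj₁ (grow false))       = there (here refl)
linked-neighbour (inj₁ (grow true))        = there (there (here refl))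
linked-neighbour (inj₂ (move _))           = there (there (there (here refl)))
linked-neighbour (inj₂ (grow {b} {w} z))   = there (there (there (there (here (sym (grow-parent b w z))))))

-- Neighbours of a are canonical and their nodes are among the five
-- neighbours of the node of a, which determine them.
bounded-degree : BoundedDegree P
bounded-degree = 5 , λ a xs adjacent distinct →
  pigeonhole _≈_ (λ b → Adj P a b × ¬ (a ≈ b)) (λ b → decode (proj₁ b))
    (λ {x} {y} qx qy eq →
      ≡⇒≈ {x} {y} (canonical-injective (neighbour-canonical {a} {x} qx) (neighbour-canonical {a} {y} qy) eq))
    (neighbours (decode (proj₁ a))) xs adjacent
    (λ {b} q → linked-neighbour (proj₂ (proj₂ (adjacent-linked {a} {b} (proj₁ q))))) distinct
  where
  neighbour-canonical : ∀ {a b} → Adj P a b × ¬ (a ≈ b) → Canonical (proj₁ b)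
  neighbour-canonical {a} {b} q = proj₁ (proj₂ (adjacent-linked {a} {b} (proj₁ q)))

canonical? : ∀ u → Dec (Canonical u)
canonical? u = ≡-dec _≟_ (enc (decode u)) u

-- The upper bound: a ball around a canonical string is coded injectively
-- by NodeBall.code, and a ball around any other string is a singleton.
ball-bound : ∀ s → GrowthAtMost P (tri s) (2 ^ suc (4 * s))
ball-bound s a xs within distinct with canonical? (proj₁ a)
... | yes ca = ≤-trans counted (≤-trans (≤-reflexive length-codes) (ball-count s))
  where
  open NodeBall (decode (proj₁ a)) s
  counted : length xs ≤ length codes
  counted = pigeonhole _≈_ (Within P n a) (λ b → code (decode (proj₁ b)))
    (λ {x} {y} qx qy eq →
      let (cx , wx) = within-walk {a = a} ca qx ; (cy , wy) = within-walk {a = a} ca qy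
      in ≡⇒≈ {x} {y} (canonical-injective cx cy (code-injective wx wy eq)))
    codes xs within (λ q → code∈codes (proj₂ (within-walk {a = a} ca q))) distinct
... | no nca = ≤-trans counted (m^n>0 2 (suc (4 * s)))
  where
  counted : length xs ≤ 1
  counted = pigeonhole _≈_ (Within P (tri s) a) proj₁ (λ {x} {y} _ _ → ≡⇒≈ {x} {y}) [ proj₁ a ] xs within
              (λ {b} q → here (isolated {a = a} {b} nca q)) distinct

-- The lower bound: from the root ([0] , 0), the 2^m nodes (0t , 0) with
-- |t| = m are at distance tri m, and they are pairwise distinct.
root : Node
root = false ∷ [] , 0

reach-level : ∀ t → Within P (tri (length t)) (elt root) (elt (false ∷ t , 0))
reach-level t with path-walk (descend false [] t)
... | k , w , eq = walk-within (subst (λ r → Walk r root (false ∷ t , 0)) k≡tri w)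
  where
  k≡tri : k ≡ tri (length t)
  k≡tri = sym (+-cancelʳ-≡ 0 _ _ eq)

level : ℕ → List Elt
level m = map (λ t → elt (false ∷ t , 0)) (words m)

lower-bound : ∀ m → BallAtLeast P (tri m) (elt root) (2 ^ m)
lower-bound m = level m , within , distinct , ≤-reflexive (sym size)
  where
  within : All (Within P (tri m) (elt root)) (level m)
  within = map⁺ (All-map (λ {t} len → subst (λ l → Within P (tri l) (elt root) (elt (false ∷ t , 0))) len
                                              (reach-level t))
                         (words-length m))
  distinct : Distinct P (level m)
  distinct = AllPairs.map⁺ (AllPairs-map (λ {t} {t′} t≢t′ h → t≢t′ (∷-injectiveʳ (begin
      false ∷ t                           ≡⟨ bits-mark (false ∷ t) 0 ⟨
      map bitOf (mark (false ∷ t) 0)      ≡⟨ cong (map bitOf) (≈⇒≡ {elt (false ∷ t , 0)} {elt (false ∷ t′ , 0)} h) ⟩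
      map bitOf (mark (false ∷ t′) 0)     ≡⟨ bits-mark (false ∷ t′) 0 ⟩
      false ∷ t′                          ∎))) (words-distinct m))
    where open ≡-Reasoning
  size : length (level m) ≡ 2 ^ m
  size = trans (length-map _ (words m)) (length-words m)

norm-growth-cap : ∀ s x → NormGrowthAtLeast P (tri s) x → x ≤ 2 ^ suc (4 * s)
norm-growth-cap s x (inj₁ x≤n)                               = ≤-trans x≤n (tri≤2^ s)
norm-growth-cap s x (inj₂ (a , xs , within , distinct , x≤)) = ≤-trans x≤ (ball-bound s a xs within distinct)

-- g(tri m) ≥ 2^m, while poly<exp makes C·(tri m)^d ≤ C·m^(2d) < 2^m.
not-polynomial : ¬ PolyGrowth P
not-polynomial (C , d , N , poly) =
  let (m , N≤m , small)                 = poly<exp C (d + d) N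
      (xs , within , distinct , 2^m≤)  = lower-bound m
      at-most                          = proj₂ (poly (tri m) (≤-trans N≤m (n≤tri m))) (elt root) xs within distinct
  in <⇒≱ small (≤-trans 2^m≤ (≤-trans at-most (*-monoʳ-≤ C (tri-power m d))))

-- g'(tri s) ≤ 2^(4s+1), and (2^(4s+1))^(c+1) < 2^(tri s) for large s.
not-exponential : ¬ ExpGrowth P
not-exponential (c , N , expo) =
  let (s , N≤s , small)     = linear<tri (suc c) N
      (x , big , x-growth)  = expo (tri s) (≤-trans N≤s (n≤tri s))
  in power-gap s c x small (norm-growth-cap s x x-growth) big

lemma5 : ∃[ P ] (IsCongruence P × BoundedDegree P × ¬ PolyGrowth P × ¬ ExpGrowth P)
lemma5 = P , congruence , bounded-degree , not-polynomial , not-exponential
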